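{- Let $(Q,\mathbf{z})$ be a weak scaffold for $\pi_\bullet$, with a chosen coloring $c$. Then the modified tropical Plücker vector $\bar\pi_\bullet$ is an integral tropical Plücker vector, i.e. $\bar\pi_\bullet\in\mathrm{Dr}(k,n)\cap\mathbb{Z}^{\binom{[n]}{k}}$.
   Context: Fix $k\ge2$. $Q$ is a finite loopless directed graph; $\delta(v,w)$ is the minimum cost of a path from $v$ to $w$, a forward edge costing $1$ and a backward edge costing $k-1$ (with the standing assumption that adjacent $v\to w$ have $\delta(v,w)=1$, $\delta(w,v)=k-1$). $\mathbf{z}\in V(Q)^n$; $\pi_I(Q,\mathbf{z})=-\frac1k\min_{x\in V(Q)}\sum_{i\in I}\delta(x,z_i)$ for $I\in\binom{[n]}{k}$. A coloring is $c:V(Q)\to\mathbb{Z}/k\mathbb{Z}$ with $c(w)=c(v)+1$ for each edge $v\to w$. $(Q,\mathbf{z})$ is a weak scaffold for $\pi$ if $\pi=\pi_\bullet(Q,\mathbf{z})$ is a tropical Plücker vector (element of $\mathrm{Dr}(k,n)$: for $S\in\binom{[n]}{k-2}$ and $a<b<c<d$ outside $S$, the minimum of $\pi_{Sab}+\pi_{Scd},\pi_{Sac}+\pi_{Sbd},\pi_{Sad}+\pi_{Sbc}$ is attained twice) and $Q$ admits a coloring. Identifying $\mathbb{Z}/k$ with $\{0,\dots,k-1\}$, the modified vector is $\bar\pi_I=\pi_I+\frac1k\sum_{i\in I}c(z_i)$. -}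

module Defs where

open import Data.Nat as ℕ using (ℕ; zero; suc; _+_; _∸_; _≤_)
open import Data.Integer as ℤ using (ℤ; +_)
open import Data.Rational as ℚ using (ℚ)
open import Data.Fin using (Fin; toℕ; _<_)
open import Data.Fin.Subset using (Subset; _∪_; ⁅_⁆; ∣_∣; _∉_)
open import Data.Vec using ([]; _∷_)
open import Data.Bool using (true; false)
open import Data.Product using (Σ; _×_; ∃)
open import Data.Sum using (_⊎_)
open import Relation.Binary.PropositionalEquality using (_≡_)
open import Relation.Nullary using (¬_)

-- Directed graphs on vertex set Fin m, edges given by a relation E u v
-- ("there is an edge u → v").

Loopless : {m : ℕ} → (Fin m → Fin m → Set) → Set
Loopless E = ∀ v → ¬ E v v

data Walk {m : ℕ} (E : Fin m → Fin m → Set) : Fin m → Fin m → Set where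
  here : ∀ {v} → Walk E v v
  fwd  : ∀ {u v w} → E u v → Walk E v w → Walk E u w
  bwd  : ∀ {u v w} → E v u → Walk E v w → Walk E u w

cost : {m : ℕ} {E : Fin m → Fin m → Set} (k : ℕ) {v w : Fin m} → Walk E v w → ℕ
cost k here       = 0
cost k (fwd _ p)  = 1 + cost k p
cost k (bwd _ p)  = (k ∸ 1) + cost k p

IsMinCost : {m : ℕ} (E : Fin m → Fin m → Set) (k : ℕ) (δ : Fin m → Fin m → ℕ) → Set
IsMinCost E k δ =
  ∀ v w → Σ (Walk E v w) (λ p → cost k p ≡ δ v w)
        × (∀ (p : Walk E v w) → δ v w ≤ cost k p)

StandingAssumption : {m : ℕ} (E : Fin m → Fin m → Set) (k : ℕ) (δ : Fin m → Fin m → ℕ) → Set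
StandingAssumption E k δ = ∀ v w → E v w → δ v w ≡ 1 × δ w v ≡ k ∸ 1

-- Colorings c : V(Q) → ℤ/kℤ, with ℤ/kℤ identified with Fin k = {0,…,k-1}.

SucMod : (k : ℕ) → Fin k → Fin k → Set
SucMod k a b = (suc (toℕ a) ≡ toℕ b) ⊎ (suc (toℕ a) ≡ k × toℕ b ≡ 0)

IsColoring : {m : ℕ} (E : Fin m → Fin m → Set) (k : ℕ) (c : Fin m → Fin k) → Set
IsColoring E k c = ∀ u v → E u v → SucMod k (c u) (c v)

sumSub : {n : ℕ} → Subset n → (Fin n → ℕ) → ℕ
sumSub {zero}  []          f = 0
sumSub {suc n} (true ∷ I)  f = f Fin.zero + sumSub I (λ i → f (Fin.suc i))
  where import Data.Fin as Fin
sumSub {suc n} (false ∷ I) f = sumSub I (λ i → f (Fin.suc i))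
  where import Data.Fin as Fin

minFin : {m : ℕ} → (Fin m → ℕ) → ℕ
minFin {zero}        f = 0
minFin {suc zero}    f = f Fin.zero
  where import Data.Fin as Fin
minFin {suc (suc m)} f = f Fin.zero ℕ.⊓ minFin (λ i → f (Fin.suc i))
  where import Data.Fin as Fin

recip : ℕ → ℚ
recip zero    = ℚ.0ℚ
recip (suc k) = (+ 1) ℚ./ suc k

piQz : {m n : ℕ} (k : ℕ) (δ : Fin m → Fin m → ℕ) (z : Fin n → Fin m) → Subset n → ℚ
piQz k δ z I = ℚ.- (recip k ℚ.* (+ (minFin (λ x → sumSub I (λ i → δ x (z i)))) ℚ./ 1))

piBar : {m n : ℕ} (k : ℕ) (π : Subset n → ℚ) (c : Fin m → Fin k) (z : Fin n → Fin m) → Subset n → ℚ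
piBar k π c z I = π I ℚ.+ recip k ℚ.* ((+ sumSub I (λ i → toℕ (c (z i)))) ℚ./ 1)

-- Tropical Plücker vectors (Dressian Dr(k,n)); vectors indexed by
-- k-subsets I of [n] are represented as functions Subset n → ℚ, of which
-- only the values on subsets of size k matter.

MinTwice : ℚ → ℚ → ℚ → Set
MinTwice x y z = (x ≡ y × x ℚ.≤ z) ⊎ (x ≡ z × x ℚ.≤ y) ⊎ (y ≡ z × y ℚ.≤ x)

IsTropPlucker : (k n : ℕ) → (Subset n → ℚ) → Set
IsTropPlucker k n π =
  ∀ (S : Subset n) → ∣ S ∣ ≡ k ∸ 2 →
  ∀ (a b c d : Fin n) → a < b → b < c → c < d →
  a ∉ S → b ∉ S → c ∉ S → d ∉ S →
  MinTwice (π (S ∪ ⁅ a ⁆ ∪ ⁅ b ⁆) ℚ.+ π (S ∪ ⁅ c ⁆ ∪ ⁅ d ⁆))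
           (π (S ∪ ⁅ a ⁆ ∪ ⁅ c ⁆) ℚ.+ π (S ∪ ⁅ b ⁆ ∪ ⁅ d ⁆))
           (π (S ∪ ⁅ a ⁆ ∪ ⁅ d ⁆) ℚ.+ π (S ∪ ⁅ b ⁆ ∪ ⁅ c ⁆))

IsIntegral : (k n : ℕ) → (Subset n → ℚ) → Set
IsIntegral k n π = ∀ (I : Subset n) → ∣ I ∣ ≡ k → ∃ λ (j : ℤ) → π I ≡ j ℚ./ 1

-- An edge v → w raises the colour by 1 at cost 1 and, traversed backwards, lowers it by 1 at
-- cost k − 1 ≡ −1 (mod k); hence δ(x, w) ≡ c(w) − c(x) (mod k). For |I| = k the constant c(x)
-- is counted k times, so Σ_{i∈I} δ(x, z_i) ≡ Σ_{i∈I} c(z_i) (mod k) for every x, in particular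
-- for the minimiser, and k π̄_I is divisible by k. The correction (1/k) Σ_{i∈I} c(z_i) is
-- additive in I, so it adds the same constant to all three terms of every three-term Plücker
-- relation, and the minimum is still attained twice.

module Submission where

open import Defs
open import Data.Nat using (ℕ; _≤_)
open import Data.Fin using (Fin)
open import Data.Product using (_×_)

open import Data.Nat as ℕ using (zero; suc; _+_; _*_; _%_; _/_; NonZero; s≤s)
import Data.Nat.Properties as ℕ
open import Data.Nat.DivMod using (%-distribˡ-+; [m+n]%n≡m%n; [m+kn]%n≡m%n; m≡m%n+[m/n]*n)
import Data.Nat.Tactic.RingSolver as ℕ-Solver
open import Data.Integer as ℤ using (ℤ; +_)
import Data.Integer.Properties as ℤ
import Data.Integer.Tactic.RingSolver as ℤ-Solver
open import Data.Rational as ℚ using (ℚ; toℚᵘ)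
import Data.Rational.Properties as ℚ
open import Data.Rational.Solver using (module +-*-Solver)
open import Data.Rational.Unnormalised as ℚᵘ using (mkℚᵘ; *≡*)
import Data.Rational.Unnormalised.Properties as ℚᵘ
open import Data.Fin as Fin using (toℕ; _<_)
open import Data.Fin.Properties using (<-trans; <-irrefl)
open import Function using (_∘_)
open import Data.Fin.Subset using (Subset; _∪_; ⁅_⁆; ∣_∣; _∉_)
open import Data.Fin.Subset.Properties using (∪-assoc; ∪-identityʳ; x∈p∪q⁻; x∈⁅y⁆⇒x≡y)
open import Data.Vec using ([]; _∷_; here; there)
open import Data.Bool using (true; false)
open import Data.Product using (∃; _,_; proj₁)
open import Data.Sum using (inj₁; inj₂)
open import Data.Empty using (⊥-elim)
open import Relation.Binary.PropositionalEquality

sumSub-+-const : ∀ {n} (I : Subset n) (f : Fin n → ℕ) (a : ℕ) →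
                 sumSub I (λ i → f i + a) ≡ sumSub I f + ∣ I ∣ * a
sumSub-+-const []          f a = refl
sumSub-+-const (true ∷ I)  f a =
  trans (cong (_+_ (f Fin.zero + a)) (sumSub-+-const I (λ i → f (Fin.suc i)) a))
        (shuffle (f Fin.zero) a (sumSub I (λ i → f (Fin.suc i))) ∣ I ∣)
  where
  shuffle : ∀ x a s N → x + a + (s + N * a) ≡ x + s + suc N * a
  shuffle = ℕ-Solver.solve-∀
sumSub-+-const (false ∷ I) f a = sumSub-+-const I (λ i → f (Fin.suc i)) a

sumSub-∪-⁅⁆ : ∀ {n} (A : Subset n) (a : Fin n) (w : Fin n → ℕ) → a ∉ A →
              sumSub (A ∪ ⁅ a ⁆) w ≡ sumSub A w + w a
sumSub-∪-⁅⁆ (true ∷ A)  Fin.zero    w a∉A = ⊥-elim (a∉A here)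
sumSub-∪-⁅⁆ (false ∷ A) Fin.zero    w a∉A rewrite ∪-identityʳ A = ℕ.+-comm (w Fin.zero) _
sumSub-∪-⁅⁆ (true ∷ A)  (Fin.suc a) w a∉A =
  trans (cong (_+_ (w Fin.zero)) (sumSub-∪-⁅⁆ A a (λ i → w (Fin.suc i)) (a∉A ∘ there)))
        (sym (ℕ.+-assoc (w Fin.zero) _ _))
sumSub-∪-⁅⁆ (false ∷ A) (Fin.suc a) w a∉A = sumSub-∪-⁅⁆ A a (λ i → w (Fin.suc i)) (a∉A ∘ there)

minFin-attained : ∀ {m} (f : Fin (suc m) → ℕ) → ∃ λ x → minFin f ≡ f x
minFin-attained {zero}  f = Fin.zero , refl
minFin-attained {suc m} f with ℕ.⊓-sel (f Fin.zero) (minFin (λ i → f (Fin.suc i)))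
... | inj₁ min≡f0 = Fin.zero , min≡f0
... | inj₂ min≡rest with minFin-attained (λ i → f (Fin.suc i))
...   | x , rest≡fx = Fin.suc x , trans min≡rest rest≡fx

index-of-nonempty : ∀ {n j} (I : Subset n) → ∣ I ∣ ≡ suc j → Fin n
index-of-nonempty {suc n} _  _ = Fin.zero
index-of-nonempty {zero}  [] ()

%-cong-+ : ∀ {a a′ b b′ d} .{{_ : NonZero d}} → a % d ≡ a′ % d → b % d ≡ b′ % d →
           (a + b) % d ≡ (a′ + b′) % d
%-cong-+ {a} {a′} {b} {b′} {d} a≡a′ b≡b′ = begin
  (a + b) % d              ≡⟨ %-distribˡ-+ a b d ⟩
  (a % d + b % d) % d      ≡⟨ cong₂ (λ x y → (x + y) % d) a≡a′ b≡b′ ⟩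
  (a′ % d + b′ % d) % d    ≡⟨ %-distribˡ-+ a′ b′ d ⟨
  (a′ + b′) % d            ∎
  where open ≡-Reasoning

sumSub-cong-% : ∀ {n d} .{{_ : NonZero d}} (I : Subset n) {f g : Fin n → ℕ} →
                (∀ i → f i % d ≡ g i % d) → sumSub I f % d ≡ sumSub I g % d
sumSub-cong-% []          f≡g = refl
sumSub-cong-% (true ∷ I)  f≡g = %-cong-+ (f≡g Fin.zero) (sumSub-cong-% I (f≡g ∘ Fin.suc))
sumSub-cong-% (false ∷ I) f≡g = sumSub-cong-% I (f≡g ∘ Fin.suc)

minFin-% : ∀ {m d r} .{{_ : NonZero d}} (f : Fin m → ℕ) → Fin m →
           (∀ x → f x % d ≡ r) → minFin f % d ≡ r
minFin-% {suc m} f _ f≡r with minFin-attained f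
... | x , min≡fx = trans (cong (_% _) min≡fx) (f≡r x)

pos-divMod : ∀ m d .{{_ : NonZero d}} → + m ≡ + (m % d) ℤ.+ + (m / d) ℤ.* + d
pos-divMod m d = begin
  + m                              ≡⟨ cong +_ (m≡m%n+[m/n]*n m d) ⟩
  + (m % d + m / d * d)            ≡⟨ ℤ.pos-+ (m % d) (m / d * d) ⟩
  + (m % d) ℤ.+ + (m / d * d)      ≡⟨ cong (ℤ._+_ (+ (m % d))) (ℤ.pos-* (m / d) d) ⟩
  + (m % d) ℤ.+ + (m / d) ℤ.* + d  ∎
  where open ≡-Reasoning

%-≡⇒≡+* : ∀ M C d .{{_ : NonZero d}} → M % d ≡ C % d →
          + C ≡ + M ℤ.+ + d ℤ.* (+ (C / d) ℤ.- + (M / d))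
%-≡⇒≡+* M C d M≡C = begin
  + C                                   ≡⟨ pos-divMod C d ⟩
  + (C % d) ℤ.+ + (C / d) ℤ.* + d       ≡⟨ cong (λ r → + r ℤ.+ + (C / d) ℤ.* + d) M≡C ⟨
  + (M % d) ℤ.+ + (C / d) ℤ.* + d       ≡⟨ regroup (+ (M % d)) (+ (M / d)) (+ (C / d)) (+ d) ⟩
  (+ (M % d) ℤ.+ + (M / d) ℤ.* + d) ℤ.+ + d ℤ.* q
                                        ≡⟨ cong (λ x → x ℤ.+ + d ℤ.* q) (pos-divMod M d) ⟨
  + M ℤ.+ + d ℤ.* q                     ∎
  where
  open ≡-Reasoning
  q : ℤ
  q = + (C / d) ℤ.- + (M / d)
  regroup : ∀ r p q d → r ℤ.+ q ℤ.* d ≡ (r ℤ.+ p ℤ.* d) ℤ.+ d ℤ.* (q ℤ.- p)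
  regroup = ℤ-Solver.solve-∀

SucMod⇒suc-% : ∀ {K} .{{_ : NonZero K}} {a b : Fin K} → SucMod K a b →
               suc (toℕ a) % K ≡ toℕ b % K
SucMod⇒suc-%     (inj₁ suc-a≡b)          = cong (_% _) suc-a≡b
SucMod⇒suc-% {K} (inj₂ (suc-a≡K , b≡0)) rewrite suc-a≡K | b≡0 = [m+n]%n≡m%n 0 K

module _ {m K} .{{_ : NonZero K}} {E : Fin m → Fin m → Set} {c : Fin m → Fin K}
         (colouring : IsColoring E K c) where

  cost-colour-% : ∀ {v w} (p : Walk E v w) → (cost K p + toℕ (c v)) % K ≡ toℕ (c w) % K
  cost-colour-% here = refl
  cost-colour-% (fwd {u} {v} {w} e p) = begin
    (suc (cost K p) + toℕ (c u)) % K  ≡⟨ cong (_% K) (ℕ.+-suc (cost K p) (toℕ (c u))) ⟨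
    (cost K p + suc (toℕ (c u))) % K  ≡⟨ %-cong-+ refl (SucMod⇒suc-% (colouring u v e)) ⟩
    (cost K p + toℕ (c v)) % K        ≡⟨ cost-colour-% p ⟩
    toℕ (c w) % K                     ∎
    where open ≡-Reasoning
  cost-colour-% (bwd {u} {v} {w} e p) = begin
    (K ℕ.∸ 1 + cost K p + toℕ (c u)) % K
      ≡⟨ %-cong-+ refl (SucMod⇒suc-% (colouring v u e)) ⟨
    (K ℕ.∸ 1 + cost K p + suc (toℕ (c v))) % K
      ≡⟨ cong (_% K) (shuffle (K ℕ.∸ 1) (cost K p) (toℕ (c v))) ⟩
    (cost K p + toℕ (c v) + suc (K ℕ.∸ 1)) % K
      ≡⟨ cong (λ k → (cost K p + toℕ (c v) + k) % K) (ℕ.suc-pred K) ⟩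
    (cost K p + toℕ (c v) + K) % K
      ≡⟨ [m+n]%n≡m%n (cost K p + toℕ (c v)) K ⟩
    (cost K p + toℕ (c v)) % K
      ≡⟨ cost-colour-% p ⟩
    toℕ (c w) % K ∎
    where
    open ≡-Reasoning
    shuffle : ∀ k x y → k + x + suc y ≡ x + y + suc k
    shuffle = ℕ-Solver.solve-∀

  module _ {δ : Fin m → Fin m → ℕ} (minCost : IsMinCost E K δ) where

    δ-colour-% : ∀ v w → (δ v w + toℕ (c v)) % K ≡ toℕ (c w) % K
    δ-colour-% v w with proj₁ (minCost v w)
    ... | p , cost≡δ = subst (λ x → (x + toℕ (c v)) % K ≡ toℕ (c w) % K) cost≡δ (cost-colour-% p)

    sum-δ-colour-% : ∀ {n} (z : Fin n → Fin m) (I : Subset n) → ∣ I ∣ ≡ K → ∀ x →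
                     sumSub I (λ i → δ x (z i)) % K ≡ sumSub I (λ i → toℕ (c (z i))) % K
    sum-δ-colour-% z I ∣I∣≡K x = begin
      Δ % K                                ≡⟨ [m+kn]%n≡m%n Δ (toℕ (c x)) K ⟨
      (Δ + toℕ (c x) * K) % K              ≡⟨ cong (λ t → (Δ + t) % K) (ℕ.*-comm (toℕ (c x)) K) ⟩
      (Δ + K * toℕ (c x)) % K              ≡⟨ cong (λ s → (Δ + s * toℕ (c x)) % K) ∣I∣≡K ⟨
      (Δ + ∣ I ∣ * toℕ (c x)) % K          ≡⟨ cong (_% K) (sumSub-+-const I (δ x ∘ z) (toℕ (c x))) ⟨
      sumSub I (λ i → δ x (z i) + toℕ (c x)) % K  ≡⟨ sumSub-cong-% I (δ-colour-% x ∘ z) ⟩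
      sumSub I (λ i → toℕ (c (z i))) % K   ∎
      where
      open ≡-Reasoning
      Δ : ℕ
      Δ = sumSub I (δ x ∘ z)

ι : ℤ → ℚ
ι i = i ℚ./ 1

-- i ℚ./ suc n unfolds to fromℚᵘ (mkℚᵘ i n); this also covers recip.
toℚᵘ-ι : ∀ i → toℚᵘ (ι i) ℚᵘ.≃ mkℚᵘ i 0
toℚᵘ-ι i = ℚ.toℚᵘ-fromℚᵘ (mkℚᵘ i 0)

ι-+ : ∀ i j → ι (i ℤ.+ j) ≡ ι i ℚ.+ ι j
ι-+ i j = ℚ.toℚᵘ-injective (begin
  toℚᵘ (ι (i ℤ.+ j))          ≈⟨ toℚᵘ-ι (i ℤ.+ j) ⟩
  mkℚᵘ (i ℤ.+ j) 0            ≈⟨ *≡* (cross-multiplied i j) ⟩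
  mkℚᵘ i 0 ℚᵘ.+ mkℚᵘ j 0      ≈⟨ ℚᵘ.+-cong (toℚᵘ-ι i) (toℚᵘ-ι j) ⟨
  toℚᵘ (ι i) ℚᵘ.+ toℚᵘ (ι j)  ≈⟨ ℚ.toℚᵘ-homo-+ (ι i) (ι j) ⟨
  toℚᵘ (ι i ℚ.+ ι j)          ∎)
  where
  open ℚᵘ.≃-Reasoning
  cross-multiplied : ∀ i j → (i ℤ.+ j) ℤ.* + 1 ≡ (i ℤ.* + 1 ℤ.+ j ℤ.* + 1) ℤ.* + 1
  cross-multiplied = ℤ-Solver.solve-∀

ι-* : ∀ i j → ι (i ℤ.* j) ≡ ι i ℚ.* ι j
ι-* i j = ℚ.toℚᵘ-injective (begin
  toℚᵘ (ι (i ℤ.* j))          ≈⟨ toℚᵘ-ι (i ℤ.* j) ⟩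
  mkℚᵘ i 0 ℚᵘ.* mkℚᵘ j 0      ≈⟨ ℚᵘ.*-cong (toℚᵘ-ι i) (toℚᵘ-ι j) ⟨
  toℚᵘ (ι i) ℚᵘ.* toℚᵘ (ι j)  ≈⟨ ℚ.toℚᵘ-homo-* (ι i) (ι j) ⟨
  toℚᵘ (ι i ℚ.* ι j)          ∎)
  where open ℚᵘ.≃-Reasoning

recip-inverse : ∀ k′ → recip (suc k′) ℚ.* ι (+ suc k′) ≡ ℚ.1ℚ
recip-inverse k′ = ℚ.toℚᵘ-injective (begin
  toℚᵘ (recip (suc k′) ℚ.* ι (+ suc k′))
    ≈⟨ ℚ.toℚᵘ-homo-* (recip (suc k′)) (ι (+ suc k′)) ⟩
  toℚᵘ (recip (suc k′)) ℚᵘ.* toℚᵘ (ι (+ suc k′))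
    ≈⟨ ℚᵘ.*-cong (ℚ.toℚᵘ-fromℚᵘ (mkℚᵘ (+ 1) k′)) (toℚᵘ-ι (+ suc k′)) ⟩
  mkℚᵘ (+ 1) k′ ℚᵘ.* mkℚᵘ (+ suc k′) 0
    ≈⟨ *≡* (cong (λ n → + suc n) (trans (ℕ.*-identityʳ (k′ + 0)) (cong (_+ 0) (sym (ℕ.*-identityʳ k′))))) ⟩
  toℚᵘ ℚ.1ℚ ∎)
  where open ℚᵘ.≃-Reasoning

recip-scaled-difference : ∀ k′ (M d : ℤ) →
  ℚ.- (recip (suc k′) ℚ.* ι M) ℚ.+ recip (suc k′) ℚ.* ι (M ℤ.+ + suc k′ ℤ.* d) ≡ ι d
recip-scaled-difference k′ M d = begin
  ℚ.- (r ℚ.* ι M) ℚ.+ r ℚ.* ι (M ℤ.+ + suc k′ ℤ.* d)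
    ≡⟨ cong (λ x → ℚ.- (r ℚ.* ι M) ℚ.+ r ℚ.* x) (trans (ι-+ M _) (cong (ℚ._+_ (ι M)) (ι-* (+ suc k′) d))) ⟩
  ℚ.- (r ℚ.* ι M) ℚ.+ r ℚ.* (ι M ℚ.+ ι (+ suc k′) ℚ.* ι d)
    ≡⟨ cancel r (ι M) (ι (+ suc k′)) (ι d) ⟩
  r ℚ.* ι (+ suc k′) ℚ.* ι d
    ≡⟨ cong (ℚ._* ι d) (recip-inverse k′) ⟩
  ℚ.1ℚ ℚ.* ι d
    ≡⟨ ℚ.*-identityˡ (ι d) ⟩
  ι d ∎
  where
  open ≡-Reasoning
  r : ℚ
  r = recip (suc k′)
  cancel : ∀ r x y z → ℚ.- (r ℚ.* x) ℚ.+ r ℚ.* (x ℚ.+ y ℚ.* z) ≡ r ℚ.* y ℚ.* z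
  cancel = solve 4 (λ r x y z → :- (r :* x) :+ r :* (x :+ y :* z) := r :* y :* z) refl
    where open +-*-Solver

record Additive {n} (L : Subset n → ℚ) (ℓ : Fin n → ℚ) : Set where
  field
    ∪-⁅⁆ : ∀ A a → a ∉ A → L (A ∪ ⁅ a ⁆) ≡ L A ℚ.+ ℓ a

∉-∪-⁅⁆ : ∀ {n} {S : Subset n} {a b} → b ∉ S → a < b → b ∉ S ∪ ⁅ a ⁆
∉-∪-⁅⁆ {S = S} {a} b∉S a<b b∈S∪a with x∈p∪q⁻ S ⁅ a ⁆ b∈S∪a
... | inj₁ b∈S = b∉S b∈S
... | inj₂ b∈a = <-irrefl (sym (x∈⁅y⁆⇒x≡y a b∈a)) a<b

Additive-∪-pair : ∀ {n} {L : Subset n → ℚ} {ℓ} → Additive L ℓ → ∀ S {a b} →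
                  a ∉ S → b ∉ S → a < b → L (S ∪ ⁅ a ⁆ ∪ ⁅ b ⁆) ≡ L S ℚ.+ ℓ a ℚ.+ ℓ b
Additive-∪-pair {L = L} {ℓ} additive S {a} {b} a∉S b∉S a<b = begin
  L (S ∪ ⁅ a ⁆ ∪ ⁅ b ⁆)    ≡⟨ cong L (∪-assoc S ⁅ a ⁆ ⁅ b ⁆) ⟨
  L ((S ∪ ⁅ a ⁆) ∪ ⁅ b ⁆)  ≡⟨ Additive.∪-⁅⁆ additive (S ∪ ⁅ a ⁆) b (∉-∪-⁅⁆ b∉S a<b) ⟩
  L (S ∪ ⁅ a ⁆) ℚ.+ ℓ b    ≡⟨ cong (ℚ._+ ℓ b) (Additive.∪-⁅⁆ additive S a a∉S) ⟩
  L S ℚ.+ ℓ a ℚ.+ ℓ b      ∎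
  where open ≡-Reasoning

MinTwice-shift : ∀ {x y z x′ y′ z′} q → x′ ≡ x ℚ.+ q → y′ ≡ y ℚ.+ q → z′ ≡ z ℚ.+ q →
                 MinTwice x y z → MinTwice x′ y′ z′
MinTwice-shift q refl refl refl (inj₁ (x≡y , x≤z)) =
  inj₁ (cong (ℚ._+ q) x≡y , ℚ.+-monoˡ-≤ q x≤z)
MinTwice-shift q refl refl refl (inj₂ (inj₁ (x≡z , x≤y))) =
  inj₂ (inj₁ (cong (ℚ._+ q) x≡z , ℚ.+-monoˡ-≤ q x≤y))
MinTwice-shift q refl refl refl (inj₂ (inj₂ (y≡z , y≤x))) =
  inj₂ (inj₂ (cong (ℚ._+ q) y≡z , ℚ.+-monoˡ-≤ q y≤x))

IsTropPlucker-+-Additive : ∀ {k n} {P L : Subset n → ℚ} {ℓ} → Additive L ℓ →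
                           IsTropPlucker k n P → IsTropPlucker k n (λ I → P I ℚ.+ L I)
IsTropPlucker-+-Additive {P = P} {L} {ℓ} additive trop S ∣S∣ a b c d a<b b<c c<d a∉S b∉S c∉S d∉S =
  MinTwice-shift q (shifted a∉S b∉S c∉S d∉S a<b c<d refl)
                   (shifted a∉S c∉S b∉S d∉S a<c b<d (acbd≡abcd (ℓ a) (ℓ b) (ℓ c) (ℓ d)))
                   (shifted a∉S d∉S b∉S c∉S a<d b<c (adbc≡abcd (ℓ a) (ℓ b) (ℓ c) (ℓ d)))
                   (trop S ∣S∣ a b c d a<b b<c c<d a∉S b∉S c∉S d∉S)
  where
  open +-*-Solver
  a<c : a < c
  a<c = <-trans a<b b<c
  b<d : b < d
  b<d = <-trans b<c c<d
  a<d : a < d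
  a<d = <-trans a<c c<d
  q : ℚ
  q = (L S ℚ.+ L S) ℚ.+ ((ℓ a ℚ.+ ℓ b) ℚ.+ (ℓ c ℚ.+ ℓ d))

  acbd≡abcd : ∀ a b c d → (a ℚ.+ c) ℚ.+ (b ℚ.+ d) ≡ (a ℚ.+ b) ℚ.+ (c ℚ.+ d)
  acbd≡abcd = solve 4 (λ a b c d → (a :+ c) :+ (b :+ d) := (a :+ b) :+ (c :+ d)) refl
  adbc≡abcd : ∀ a b c d → (a ℚ.+ d) ℚ.+ (b ℚ.+ c) ≡ (a ℚ.+ b) ℚ.+ (c ℚ.+ d)
  adbc≡abcd = solve 4 (λ a b c d → (a :+ d) :+ (b :+ c) := (a :+ b) :+ (c :+ d)) refl

  regroup : ∀ p p′ s x y u v → (p ℚ.+ (s ℚ.+ x ℚ.+ y)) ℚ.+ (p′ ℚ.+ (s ℚ.+ u ℚ.+ v))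
                               ≡ (p ℚ.+ p′) ℚ.+ ((s ℚ.+ s) ℚ.+ ((x ℚ.+ y) ℚ.+ (u ℚ.+ v)))
  regroup = solve 7 (λ p p′ s x y u v → (p :+ (s :+ x :+ y)) :+ (p′ :+ (s :+ u :+ v))
                                        := (p :+ p′) :+ ((s :+ s) :+ ((x :+ y) :+ (u :+ v)))) refl

  shifted : ∀ {x y u v} → x ∉ S → y ∉ S → u ∉ S → v ∉ S → x < y → u < v →
            (ℓ x ℚ.+ ℓ y) ℚ.+ (ℓ u ℚ.+ ℓ v) ≡ (ℓ a ℚ.+ ℓ b) ℚ.+ (ℓ c ℚ.+ ℓ d) →
            (P (S ∪ ⁅ x ⁆ ∪ ⁅ y ⁆) ℚ.+ L (S ∪ ⁅ x ⁆ ∪ ⁅ y ⁆))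
              ℚ.+ (P (S ∪ ⁅ u ⁆ ∪ ⁅ v ⁆) ℚ.+ L (S ∪ ⁅ u ⁆ ∪ ⁅ v ⁆))
              ≡ (P (S ∪ ⁅ x ⁆ ∪ ⁅ y ⁆) ℚ.+ P (S ∪ ⁅ u ⁆ ∪ ⁅ v ⁆)) ℚ.+ q
  shifted {x} {y} {u} {v} x∉S y∉S u∉S v∉S x<y u<v xyuv≡abcd = begin
    (Pxy ℚ.+ L (S ∪ ⁅ x ⁆ ∪ ⁅ y ⁆)) ℚ.+ (Puv ℚ.+ L (S ∪ ⁅ u ⁆ ∪ ⁅ v ⁆))
      ≡⟨ cong₂ (λ s t → (Pxy ℚ.+ s) ℚ.+ (Puv ℚ.+ t))
               (Additive-∪-pair additive S x∉S y∉S x<y) (Additive-∪-pair additive S u∉S v∉S u<v) ⟩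
    (Pxy ℚ.+ (L S ℚ.+ ℓ x ℚ.+ ℓ y)) ℚ.+ (Puv ℚ.+ (L S ℚ.+ ℓ u ℚ.+ ℓ v))
      ≡⟨ regroup Pxy Puv (L S) (ℓ x) (ℓ y) (ℓ u) (ℓ v) ⟩
    (Pxy ℚ.+ Puv) ℚ.+ ((L S ℚ.+ L S) ℚ.+ ((ℓ x ℚ.+ ℓ y) ℚ.+ (ℓ u ℚ.+ ℓ v)))
      ≡⟨ cong (λ t → (Pxy ℚ.+ Puv) ℚ.+ ((L S ℚ.+ L S) ℚ.+ t)) xyuv≡abcd ⟩
    (Pxy ℚ.+ Puv) ℚ.+ q ∎
    where
    open ≡-Reasoning
    Pxy Puv : ℚ
    Pxy = P (S ∪ ⁅ x ⁆ ∪ ⁅ y ⁆)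
    Puv = P (S ∪ ⁅ u ⁆ ∪ ⁅ v ⁆)

recip-weight-Additive : ∀ k {n} (w : Fin n → ℕ) →
  Additive (λ I → recip k ℚ.* ι (+ sumSub I w)) (λ i → recip k ℚ.* ι (+ w i))
recip-weight-Additive k w .Additive.∪-⁅⁆ A a a∉A = begin
  recip k ℚ.* ι (+ sumSub (A ∪ ⁅ a ⁆) w)
    ≡⟨ cong (λ s → recip k ℚ.* ι (+ s)) (sumSub-∪-⁅⁆ A a w a∉A) ⟩
  recip k ℚ.* ι (+ (sumSub A w + w a))
    ≡⟨ cong (λ x → recip k ℚ.* x) (trans (cong ι (ℤ.pos-+ (sumSub A w) (w a))) (ι-+ (+ sumSub A w) (+ w a))) ⟩
  recip k ℚ.* (ι (+ sumSub A w) ℚ.+ ι (+ w a))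
    ≡⟨ ℚ.*-distribˡ-+ (recip k) (ι (+ sumSub A w)) (ι (+ w a)) ⟩
  recip k ℚ.* ι (+ sumSub A w) ℚ.+ recip k ℚ.* ι (+ w a)  ∎
  where open ≡-Reasoning

piBar-integral : ∀ k′ {m n} {E : Fin m → Fin m → Set} {δ : Fin m → Fin m → ℕ} →
                 IsMinCost E (suc k′) δ →
                 {c : Fin m → Fin (suc k′)} → IsColoring E (suc k′) c → (z : Fin n → Fin m) →
                 IsIntegral (suc k′) n (piBar (suc k′) (piQz (suc k′) δ z) c z)
piBar-integral k′ {δ = δ} minCost {c} colouring z I ∣I∣≡K = q , (begin
  ℚ.- (recip K ℚ.* ι (+ M)) ℚ.+ recip K ℚ.* ι (+ C)
    ≡⟨ cong (λ x → ℚ.- (recip K ℚ.* ι (+ M)) ℚ.+ recip K ℚ.* ι x) (%-≡⇒≡+* M C K M≡C) ⟩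
  ℚ.- (recip K ℚ.* ι (+ M)) ℚ.+ recip K ℚ.* ι (+ M ℤ.+ + K ℤ.* q)
    ≡⟨ recip-scaled-difference k′ (+ M) q ⟩
  ι q ∎)
  where
  open ≡-Reasoning
  K M C : ℕ
  K = suc k′
  M = minFin (λ x → sumSub I (λ i → δ x (z i)))
  C = sumSub I (λ i → toℕ (c (z i)))
  q : ℤ
  q = + (C / K) ℤ.- + (M / K)
  M≡C : M % K ≡ C % K
  M≡C = minFin-% _ (z (index-of-nonempty I ∣I∣≡K)) (sum-δ-colour-% colouring minCost z I ∣I∣≡K)

proposition3p11 : (k : ℕ) → 2 ≤ k →
    (m n : ℕ) (E : Fin m → Fin m → Set) → Loopless E →
    (δ : Fin m → Fin m → ℕ) → IsMinCost E k δ → StandingAssumption E k δ →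
    (z : Fin n → Fin m) →
    IsTropPlucker k n (piQz k δ z) →
    (c : Fin m → Fin k) → IsColoring E k c →
    IsTropPlucker k n (piBar k (piQz k δ z) c z)
      × IsIntegral k n (piBar k (piQz k δ z) c z)
proposition3p11 (suc k′) (s≤s _) m n E _ δ minCost _ z trop c colouring =
  IsTropPlucker-+-Additive {suc k′} {P = piQz (suc k′) δ z}
    (recip-weight-Additive (suc k′) (toℕ ∘ c ∘ z)) trop ,
  piBar-integral k′ minCost colouring z
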